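{- Let $G$ be a non-bipartite graph. If $\chi(G)\le 10$, then $\chi_2\big(G^{\frac13}\big)=5$; otherwise $\chi_2\big(G^{\frac13}\big)=6$.
   Context: For positive integers $m\ge 2n$, the Kneser graph $\mathrm{KG}(m,n)$ has as vertices the $n$-subsets of $\{1,\dots,m\}$, two being adjacent iff they are disjoint. The $2$nd multichromatic number $\chi_2(H)$ is the smallest $m$ such that $H$ admits a homomorphism to $\mathrm{KG}(m,2)$. $\chi(G)$ is the chromatic number. $G^{1/3}$ is the graph obtained from $G$ by replacing each edge by a path with $3$ edges. -}

module Defs where

open import Data.Nat using (ℕ; _<_)
open import Data.Fin using (Fin)
open import Data.Fin.Subset using (Subset; ∣_∣; _∩_; Empty)
open import Data.Bool using (Bool; T; false)
open import Data.Empty using (⊥)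
open import Data.Sum using (_⊎_; inj₁; inj₂)
open import Data.Product using (Σ; _×_; _,_; proj₁; proj₂)
open import Relation.Binary.PropositionalEquality using (_≡_; _≢_)
open import Relation.Nullary using (¬_)

record FinGraph : Set where
  field
    n     : ℕ
    adj   : Fin n → Fin n → Bool
    sym   : ∀ u v → adj u v ≡ adj v u
    irref : ∀ v → adj v v ≡ false

open FinGraph public

Colorable : FinGraph → ℕ → Set
Colorable G k = Σ (Fin (n G) → Fin k) λ c → ∀ u v → T (adj G u v) → c u ≢ c v

Bipartite : FinGraph → Set
Bipartite G = Colorable G 2

Hom : (V : Set) → (V → V → Set) → (W : Set) → (W → W → Set) → Set
Hom V E W F = Σ (V → W) λ f → ∀ {u v} → E u v → F (f u) (f v)

KGVertex : ℕ → ℕ → Set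
KGVertex m k = Σ (Subset m) λ s → ∣ s ∣ ≡ k

KGAdj : ∀ {m k} → KGVertex m k → KGVertex m k → Set
KGAdj (s , _) (t , _) = Empty (s ∩ t)

Chi2Is : (V : Set) → (V → V → Set) → ℕ → Set
Chi2Is V E m = Hom V E (KGVertex m 2) KGAdj
             × (∀ m' → m' < m → ¬ Hom V E (KGVertex m' 2) KGAdj)

-- Vertices: original vertices, plus for each
-- ordered adjacent pair (a,b) an internal vertex mid(a,b) (the one next to a
-- on the path replacing edge ab). Edge ab becomes a - mid(a,b) - mid(b,a) - b.
SubV : FinGraph → Set
SubV G = Fin (n G) ⊎ Σ (Fin (n G) × Fin (n G)) λ p → T (adj G (proj₁ p) (proj₂ p))

SubAdj : (G : FinGraph) → SubV G → SubV G → Set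
SubAdj G (inj₁ u) (inj₁ v) = ⊥
SubAdj G (inj₁ u) (inj₂ ((a , b) , _)) = u ≡ a
SubAdj G (inj₂ ((a , b) , _)) (inj₁ u) = u ≡ a
SubAdj G (inj₂ ((a , b) , _)) (inj₂ ((c , d) , _)) = (a ≡ d) × (b ≡ c)

-- Homomorphisms G^{1/3} → K correspond to maps c : V(G) → V(K) sending every edge
-- of G to a pair of vertices joined by a walk of length 3 in K.
-- If K has a triangle, the constant map works, so KG(6,2) always receives G^{1/3}.
-- If K is triangle-free, such a c is a proper colouring of G by V(K); KG(m,2) is
-- bipartite for m ≤ 4 and the Petersen graph KG(5,2) is triangle-free with ten
-- vertices, which gives the lower bounds.  Conversely any two distinct vertices of
-- the Petersen graph are joined by a 3-walk, so a 10-colouring of G turns into a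
-- homomorphism G^{1/3} → KG(5,2).
module Submission where

open import Defs
open import Data.Bool using (T)
open import Data.Bool.Properties using (T-irrelevant)
open import Data.Empty using (⊥; ⊥-elim)
open import Data.Fin using (Fin; zero; suc)
open import Data.Fin.Properties as Fin using (all?; any?)
open import Data.Fin.Subset using (Subset; ∣_∣; _∩_; _∪_; Empty; inside; outside)
open import Data.Fin.Subset.Properties
  using (∣p∣≤n; drop-∷-Empty; ∩-comm; x∈p∩q⁺; x∈p∩q⁻; x∈p∪q⁻; nonempty?)
open import Data.List as List using (List; _++_; map; filter; length; lookup)
open import Data.List.Membership.Propositional using (_∈_)
open import Data.List.Membership.Propositional.Properties
  using (∈-map⁺; ∈-++⁺ˡ; ∈-++⁺ʳ; ∈-filter⁺; ∈-filter⁻; ∈-lookup)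
open import Data.List.Relation.Unary.Any as Any using (index)
open import Data.List.Relation.Unary.Any.Properties using (lookup-index)
open import Data.Nat as ℕ using (ℕ; suc; _+_; _≤_; _<_)
open import Data.Nat.Properties as ℕ using (≤-pred; ≤-trans; <-irrefl; <⇒≱; m<1+n⇒m<n∨m≡n)
open import Data.Product using (Σ; ∃₂; _×_; _,_; proj₁; proj₂)
open import Data.Product.Properties using (Σ-≡,≡→≡)
open import Data.Sum using (inj₁; inj₂; [_,_])
open import Data.Vec as Vec using ([]; _∷_; here)
open import Function using (_∘_; id; const)
open import Relation.Binary.Definitions using (Symmetric; Decidable)
open import Relation.Binary.PropositionalEquality as ≡ using (_≡_; _≢_; refl; cong; cong₂; subst)
open import Relation.Nullary using (¬_; Dec; yes; no; ¬?)
open import Relation.Nullary.Decidable using (from-yes; _×-dec_; _→-dec_)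

Hom-∘ : {U V W : Set} {D : U → U → Set} {E : V → V → Set} {F : W → W → Set} →
        Hom V E W F → Hom U D V E → Hom U D W F
Hom-∘ (g , g-hom) (f , f-hom) = g ∘ f , λ uv → g-hom (f-hom uv)

Edge : (G : FinGraph) → Fin (n G) → Fin (n G) → Set
Edge G u v = T (adj G u v)

Edge-sym : (G : FinGraph) → Symmetric (Edge G)
Edge-sym G {u} {v} = subst T (sym G u v)

Edge-irreflexive : (G : FinGraph) {u v : Fin (n G)} → u ≡ v → ¬ Edge G u v
Edge-irreflexive G {u} refl = subst T (irref G u)

colorable⇒hom : {G : FinGraph} {k : ℕ} → Colorable G k → Hom (Fin (n G)) (Edge G) (Fin k) _≢_
colorable⇒hom (c , proper) = c , λ {u} {v} → proper u v

hom⇒colorable : {G : FinGraph} {k : ℕ} → Hom (Fin (n G)) (Edge G) (Fin k) _≢_ → Colorable G k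
hom⇒colorable (c , proper) = c , λ u v → proper {u} {v}

record Walk₃ {V : Set} (F : V → V → Set) (x y : V) : Set where
  constructor walk₃
  field
    first last : V
    start  : F x first
    middle : F first last
    end    : F last y

open Walk₃

Walk₃-reverse : {V : Set} {F : V → V → Set} → Symmetric F → Symmetric (Walk₃ F)
Walk₃-reverse F-sym (walk₃ x′ y′ p q r) = walk₃ y′ x′ (F-sym r) (F-sym q) (F-sym p)

TriangleFree : {V : Set} → (V → V → Set) → Set
TriangleFree F = ∀ {x y z} → F x y → F y z → F z x → ⊥

Walk₃⇒≢ : {V : Set} {F : V → V → Set} → TriangleFree F → ∀ {x y} → Walk₃ F x y → x ≢ y
Walk₃⇒≢ triangle-free (walk₃ _ _ p q r) refl = triangle-free p q r

subdivisionHom⇒walk₃Hom : {G : FinGraph} {V : Set} {F : V → V → Set} →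
  Hom (SubV G) (SubAdj G) V F → Hom (Fin (n G)) (Edge G) V (Walk₃ F)
subdivisionHom⇒walk₃Hom {G} {F = F} (f , f-hom) = f ∘ inj₁ , path
  where
  path : ∀ {a b} → Edge G a b → Walk₃ F (f (inj₁ a)) (f (inj₁ b))
  path {a} {b} e = walk₃ (f near-a) (f near-b)
    (f-hom {inj₁ a} {near-a} refl) (f-hom {near-a} {near-b} (refl , refl)) (f-hom {near-b} {inj₁ b} refl)
    where
    near-a near-b : SubV G
    near-a = inj₂ ((a , b) , e)
    near-b = inj₂ ((b , a) , Edge-sym G e)

-- Each edge is subdivided along the walk of its orientation a ≤ b, so the two
-- internal vertices of the path read the same walk from its two ends.
walk₃Hom⇒subdivisionHom : {G : FinGraph} {V : Set} {F : V → V → Set} → Symmetric F →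
  Hom (Fin (n G)) (Edge G) V (Walk₃ F) → Hom (SubV G) (SubAdj G) V F
walk₃Hom⇒subdivisionHom {G} {V} {F} F-sym (c , c-hom) = f , f-hom
  where
  walk : ∀ a b → Edge G a b → Walk₃ F (c a) (c b)
  walk a b e with a Fin.≤? b
  ... | yes _ = c-hom e
  ... | no  _ = Walk₃-reverse F-sym (c-hom (Edge-sym G e))

  walk-reverse : ∀ a b (e : Edge G a b) (e′ : Edge G b a) → last (walk a b e) ≡ first (walk b a e′)
  walk-reverse a b e e′ with a Fin.≤? b | b Fin.≤? a
  ... | yes a≤b | yes b≤a = ⊥-elim (Edge-irreflexive G (Fin.≤-antisym a≤b b≤a) e)
  ... | yes _   | no  _   = cong (last ∘ c-hom) (T-irrelevant e (Edge-sym G e′))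
  ... | no  _   | yes _   = cong (first ∘ c-hom) (T-irrelevant (Edge-sym G e) e′)
  ... | no a≰b  | no b≰a  = ⊥-elim ([ a≰b , b≰a ] (Fin.≤-total a b))

  f : SubV G → V
  f (inj₁ a)             = c a
  f (inj₂ ((a , b) , e)) = first (walk a b e)

  f-hom : ∀ {u v} → SubAdj G u v → F (f u) (f v)
  f-hom {inj₁ _}             {inj₁ _}               ()
  f-hom {inj₁ _}             {inj₂ ((a , b) , e)}   refl        = start (walk a b e)
  f-hom {inj₂ ((a , b) , e)} {inj₁ _}               refl        = F-sym (start (walk a b e))
  f-hom {inj₂ ((a , b) , e)} {inj₂ ((_ , _) , e′)} (refl , refl) =
    subst (F _) (walk-reverse a b e e′) (middle (walk a b e))

subdivisionHom⇒colouring : {G : FinGraph} {V : Set} {F : V → V → Set} → TriangleFree F →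
  Hom (SubV G) (SubAdj G) V F → Hom (Fin (n G)) (Edge G) V _≢_
subdivisionHom⇒colouring {F = F} triangle-free h =
  Hom-∘ {E = Walk₃ F} (id , Walk₃⇒≢ triangle-free) (subdivisionHom⇒walk₃Hom h)

Fin2-triangleFree : TriangleFree (_≢_ {A = Fin 2})
Fin2-triangleFree {zero}     {zero}     p _ _ = p refl
Fin2-triangleFree {suc zero} {suc zero} p _ _ = p refl
Fin2-triangleFree {_}        {zero}     {zero}     _ q _ = q refl
Fin2-triangleFree {_}        {suc zero} {suc zero} _ q _ = q refl
Fin2-triangleFree {zero}     {suc zero} {zero}     _ _ r = r refl
Fin2-triangleFree {suc zero} {zero}     {suc zero} _ _ r = r refl

∣p∪q∣≡∣p∣+∣q∣ : ∀ {m} {p q : Subset m} → Empty (p ∩ q) → ∣ p ∪ q ∣ ≡ ∣ p ∣ + ∣ q ∣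
∣p∪q∣≡∣p∣+∣q∣ {p = []}          {[]}          _ = refl
∣p∪q∣≡∣p∣+∣q∣ {p = inside  ∷ p} {inside  ∷ q} e = ⊥-elim (e (zero , here))
∣p∪q∣≡∣p∣+∣q∣ {p = inside  ∷ p} {outside ∷ q} e = cong suc (∣p∪q∣≡∣p∣+∣q∣ (drop-∷-Empty e))
∣p∪q∣≡∣p∣+∣q∣ {p = outside ∷ p} {inside  ∷ q} e =
  ≡.trans (cong suc (∣p∪q∣≡∣p∣+∣q∣ (drop-∷-Empty e))) (≡.sym (ℕ.+-suc ∣ p ∣ ∣ q ∣))
∣p∪q∣≡∣p∣+∣q∣ {p = outside ∷ p} {outside ∷ q} e = ∣p∪q∣≡∣p∣+∣q∣ (drop-∷-Empty e)

Empty[p∩q]⇒∣p∣+∣q∣≤n : ∀ {m} {p q : Subset m} → Empty (p ∩ q) → ∣ p ∣ + ∣ q ∣ ≤ m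
Empty[p∩q]⇒∣p∣+∣q∣≤n {p = p} {q} e = subst (_≤ _) (∣p∪q∣≡∣p∣+∣q∣ e) (∣p∣≤n (p ∪ q))

Empty-∪-∩ : ∀ {m} {p q r : Subset m} → Empty (p ∩ r) → Empty (q ∩ r) → Empty ((p ∪ q) ∩ r)
Empty-∪-∩ {p = p} {q} {r} e₁ e₂ (x , x∈[p∪q]∩r) with x∈p∩q⁻ (p ∪ q) r x∈[p∪q]∩r
... | x∈p∪q , x∈r = [ (λ x∈p → e₁ (x , x∈p∩q⁺ (x∈p , x∈r))) , (λ x∈q → e₂ (x , x∈p∩q⁺ (x∈q , x∈r))) ]
                      (x∈p∪q⁻ p q x∈p∪q)

KGAdj-sym : ∀ {m k} → Symmetric (KGAdj {m} {k})
KGAdj-sym {x = s , _} {t , _} = subst Empty (∩-comm s t)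

KGAdj? : ∀ {m k} → Decidable (KGAdj {m} {k})
KGAdj? (s , _) (t , _) = ¬? (nonempty? (s ∩ t))

KG-triangleFree : ∀ {m k} → m < k + k + k → TriangleFree (KGAdj {m} {k})
KG-triangleFree {m} m<3k {s , ∣s∣≡k} {t , ∣t∣≡k} {u , ∣u∣≡k} s-t t-u u-s =
  <⇒≱ m<3k (subst (_≤ m) sizes (subst (λ x → x + ∣ u ∣ ≤ m) (∣p∪q∣≡∣p∣+∣q∣ s-t) bound))
  where
  bound : ∣ s ∪ t ∣ + ∣ u ∣ ≤ m
  bound = Empty[p∩q]⇒∣p∣+∣q∣≤n (Empty-∪-∩ (subst Empty (∩-comm u s) u-s) t-u)
  sizes : ∣ s ∣ + ∣ t ∣ + ∣ u ∣ ≡ _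
  sizes = cong₂ _+_ (cong₂ _+_ ∣s∣≡k ∣t∣≡k) ∣u∣≡k

-- Two disjoint sets avoiding the point 0 would need 2(k + 1) of the other m - 1 points.
KG-bipartite : ∀ {m k} → m ≤ suc k + suc k → Hom (KGVertex m (suc k)) KGAdj (Fin 2) _≢_
KG-bipartite {m} {k} m≤2k = colour ∘ proj₁ , λ {s} {t} → proper s t
  where
  colour : Subset m → Fin 2
  colour []            = zero
  colour (inside  ∷ _) = suc zero
  colour (outside ∷ _) = zero

  proper : (s t : KGVertex m (suc k)) → KGAdj s t → colour (proj₁ s) ≢ colour (proj₁ t)
  proper ([] , ())
  proper (inside  ∷ s , _) (inside  ∷ t , _) s-t _ = s-t (zero , here)
  proper (inside  ∷ s , _) (outside ∷ t , _) _ ()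
  proper (outside ∷ s , _) (inside  ∷ t , _) _ ()
  proper (outside ∷ s , ∣s∣≡k) (outside ∷ t , ∣t∣≡k) s-t _ = <-irrefl refl (≤-trans m≤2k 2k≤m-1)
    where
    2k≤m-1 : suc k + suc k ≤ Vec.length s
    2k≤m-1 = subst (_≤ Vec.length s) (cong₂ _+_ ∣s∣≡k ∣t∣≡k) (Empty[p∩q]⇒∣p∣+∣q∣≤n (drop-∷-Empty s-t))

allSubsets : (m : ℕ) → List (Subset m)
allSubsets ℕ.zero = List.[ [] ]
allSubsets (suc m) = map (outside ∷_) (allSubsets m) ++ map (inside ∷_) (allSubsets m)

∈-allSubsets : ∀ {m} (s : Subset m) → s ∈ allSubsets m
∈-allSubsets []            = Any.here refl
∈-allSubsets (outside ∷ s) = ∈-++⁺ˡ (∈-map⁺ (outside ∷_) (∈-allSubsets s))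
∈-allSubsets (inside  ∷ s) = ∈-++⁺ʳ _ (∈-map⁺ (inside ∷_) (∈-allSubsets s))

hasSize? : ∀ {m} (k : ℕ) (s : Subset m) → Dec (∣ s ∣ ≡ k)
hasSize? k s = ∣ s ∣ ℕ.≟ k

subsetsOfSize : (m k : ℕ) → List (Subset m)
subsetsOfSize m k = filter (hasSize? k) (allSubsets m)

KG-lookup : ∀ {m k} → Fin (length (subsetsOfSize m k)) → KGVertex m k
KG-lookup {m} {k} i = lookup (subsetsOfSize m k) i ,
  proj₂ (∈-filter⁻ (hasSize? k) {xs = allSubsets m} (∈-lookup {xs = subsetsOfSize m k} i))

KG-index : ∀ {m k} → KGVertex m k → Fin (length (subsetsOfSize m k))
KG-index {k = k} (s , ∣s∣≡k) = index (∈-filter⁺ (hasSize? k) (∈-allSubsets s) ∣s∣≡k)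

KG-index-injective : ∀ {m k} {x y : KGVertex m k} → KG-index x ≡ KG-index y → x ≡ y
KG-index-injective {m} {k} {s , _} {t , _} eq = Σ-≡,≡→≡ (s≡t , ℕ.≡-irrelevant _ _)
  where
  s≡t : s ≡ t
  s≡t = ≡.trans (lookup-index (∈-filter⁺ (hasSize? k) (∈-allSubsets s) _))
          (≡.trans (cong (lookup (subsetsOfSize m k)) eq)
            (≡.sym (lookup-index (∈-filter⁺ (hasSize? k) (∈-allSubsets t) _))))

Petersen-walk₃ : Hom (Fin 10) _≢_ (KGVertex 5 2) (Walk₃ KGAdj)
Petersen-walk₃ = v , λ {i} {j} i≢j → toWalk₃ {i} {j} (joined i j i≢j)
  where
  v : Fin 10 → KGVertex 5 2
  v = KG-lookup

  Joined : Fin 10 → Fin 10 → Set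
  Joined i j = ∃₂ λ i′ j′ → KGAdj (v i) (v i′) × KGAdj (v i′) (v j′) × KGAdj (v j′) (v j)

  joined : ∀ i j → i ≢ j → Joined i j
  joined = from-yes (all? λ i → all? λ j → ¬? (i Fin.≟ j) →-dec
             any? λ i′ → any? λ j′ →
               KGAdj? (v i) (v i′) ×-dec KGAdj? (v i′) (v j′) ×-dec KGAdj? (v j′) (v j))

  toWalk₃ : ∀ {i j} → Joined i j → Walk₃ KGAdj (v i) (v j)
  toWalk₃ (i′ , j′ , p , q , r) = walk₃ (v i′) (v j′) p q r

KG62-closedWalk₃ : Σ (KGVertex 6 2) λ x → Walk₃ KGAdj x x
KG62-closedWalk₃ = x , walk₃ y z (from-yes (KGAdj? x y)) (from-yes (KGAdj? y z)) (from-yes (KGAdj? z x))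
  where
  x y z : KGVertex 6 2
  x = (inside  ∷ inside  ∷ outside ∷ outside ∷ outside ∷ outside ∷ []) , refl
  y = (outside ∷ outside ∷ inside  ∷ inside  ∷ outside ∷ outside ∷ []) , refl
  z = (outside ∷ outside ∷ outside ∷ outside ∷ inside  ∷ inside  ∷ []) , refl

small-KG-subdivisionHom⇒bipartite : (G : FinGraph) {m : ℕ} → m ≤ 4 →
  Hom (SubV G) (SubAdj G) (KGVertex m 2) KGAdj → Bipartite G
small-KG-subdivisionHom⇒bipartite G m≤4 h =
  hom⇒colorable {G} (subdivisionHom⇒colouring {G} {F = _≢_} Fin2-triangleFree 2-colouring)
  where
  2-colouring : Hom (SubV G) (SubAdj G) (Fin 2) _≢_
  2-colouring = Hom-∘ {D = SubAdj G} {E = KGAdj} {F = _≢_} (KG-bipartite m≤4) h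

-- KGAdj only inspects the underlying sets, so its vertex arguments are never
-- inferable; hence the explicit η-expansions below.
Petersen-subdivisionHom⇒colorable : (G : FinGraph) →
  Hom (SubV G) (SubAdj G) (KGVertex 5 2) KGAdj → Colorable G 10
Petersen-subdivisionHom⇒colorable G h =
  hom⇒colorable {G} (Hom-∘ {D = Edge G} {E = _≢_} {F = _≢_} KG-index-proper Petersen-colouring)
  where
  Petersen-colouring : Hom (Fin (n G)) (Edge G) (KGVertex 5 2) _≢_
  Petersen-colouring =
    subdivisionHom⇒colouring {G} {F = KGAdj} (λ {x} {y} {z} → KG-triangleFree ℕ.≤-refl {x} {y} {z}) h

  KG-index-proper : Hom (KGVertex 5 2) _≢_ (Fin 10) _≢_
  KG-index-proper = KG-index , λ x≢y → x≢y ∘ KG-index-injective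

colorable⇒Petersen-subdivisionHom : (G : FinGraph) →
  Colorable G 10 → Hom (SubV G) (SubAdj G) (KGVertex 5 2) KGAdj
colorable⇒Petersen-subdivisionHom G col =
  walk₃Hom⇒subdivisionHom {G} {F = KGAdj} (λ {x} {y} → KGAdj-sym {x = x} {y}) walks
  where
  walks : Hom (Fin (n G)) (Edge G) (KGVertex 5 2) (Walk₃ KGAdj)
  walks = Hom-∘ {D = Edge G} {E = _≢_} {F = Walk₃ KGAdj} Petersen-walk₃ (colorable⇒hom {G} col)

KG62-subdivisionHom : (G : FinGraph) → Hom (SubV G) (SubAdj G) (KGVertex 6 2) KGAdj
KG62-subdivisionHom G = walk₃Hom⇒subdivisionHom {G} {F = KGAdj} (λ {x} {y} → KGAdj-sym {x = x} {y})
  (const (proj₁ KG62-closedWalk₃) , const (proj₂ KG62-closedWalk₃))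

corollary4 : (G : FinGraph) → ¬ Bipartite G →
    (Colorable G 10 → Chi2Is (SubV G) (SubAdj G) 5)
    × (¬ Colorable G 10 → Chi2Is (SubV G) (SubAdj G) 6)
corollary4 G non-bipartite =
    (λ col → colorable⇒Petersen-subdivisionHom G col , no-hom-below-5)
  , (λ ¬col → KG62-subdivisionHom G , no-hom-below-6 ¬col)
  where
  no-hom-below-5 : ∀ m → m < 5 → ¬ Hom (SubV G) (SubAdj G) (KGVertex m 2) KGAdj
  no-hom-below-5 m m<5 = non-bipartite ∘ small-KG-subdivisionHom⇒bipartite G (≤-pred m<5)

  no-hom-below-6 : ¬ Colorable G 10 → ∀ m → m < 6 → ¬ Hom (SubV G) (SubAdj G) (KGVertex m 2) KGAdj
  no-hom-below-6 ¬col m m<6 with m<1+n⇒m<n∨m≡n m<6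
  ... | inj₁ m<5  = no-hom-below-5 m m<5
  ... | inj₂ refl = ¬col ∘ Petersen-subdivisionHom⇒colorable G
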